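{- Let $m\ge 1$ and $n\ge 1$ be integers, and let $G=(V,E)$ be either the Kautz graph $\mathrm{Kautz}_{n+1}(m)$ or the de Bruijn graph $DB_{n+1}(m)$, and let $c=|V|/m$. Let $x_1\mid x_2\mid\cdots\mid x_{|V|}$ be the invariant factors (diagonal entries of the Smith normal form over $\mathbb{Z}$) of the Laplacian $L(G)$. Then $x_1,\ldots,x_c$ are relatively prime to $m$, and $x_{c+1},\ldots,x_{|V|}$ are all divisible by $m$.
   Context: A Kautz string is a string with no two adjacent characters equal. $\mathrm{Kautz}_k(m)$ has as vertices the Kautz strings of length $k$ over $m+1$ symbols and as edges the Kautz strings $s_0\ldots s_k$ of length $k+1$, directed from $s_0\ldots s_{k-1}$ to $s_1\ldots s_k$. $DB_k(m)$ has as vertices all strings of length $k$ over $m$ symbols and as edges all strings $s_0\ldots s_k$ of length $k+1$, directed from $s_0\ldots s_{k-1}$ to $s_1\ldots s_k$. For a directed graph with vertices $v_1,\ldots,v_N$, the adjacency matrix $A$ has $A_{ij}$ equal to the number of edges from $v_i$ to $v_j$, the degree matrix $D$ is diagonal with $D_{ii}=\mathrm{outdeg}(v_i)$, and the Laplacian is $L=A-D$. -}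

module Defs where

open import Data.Nat as ℕ using (ℕ; zero; suc)
open import Data.Bool using (Bool; true; false; not; _∧_; if_then_else_)
open import Data.Fin using (Fin; toℕ) renaming (_≟_ to _≟ᶠ_)
open import Data.Vec using (Vec; []; _∷_; tail; init; last; _∷ʳ_)
open import Data.Vec.Properties using (≡-dec)
open import Data.Integer as ℤ using (ℤ; +_; _*_; _+_; _-_)
open import Data.Integer.Divisibility using () renaming (_∣_ to _∣ℤ_)
open import Data.Product using (Σ; ∃; ∃-syntax; _×_; _,_)
open import Relation.Nullary.Decidable using (⌊_⌋)
open import Relation.Binary.PropositionalEquality using (_≡_; _≢_)
open import Function.Bundles using (_⤖_; Bijection)

isKautz : ∀ {q l} → Vec (Fin q) l → Bool
isKautz [] = true
isKautz (x ∷ []) = true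
isKautz (x ∷ y ∷ s) = not ⌊ x ≟ᶠ y ⌋ ∧ isKautz (y ∷ s)

-- The two families: Kautz_k(m) (strings over m+1 symbols, Kautz strings only)
-- and DB_k(m) (all strings over m symbols).
data Family : Set where
  kautzFam deBruijnFam : Family

alphabet : Family → ℕ → ℕ
alphabet kautzFam m = suc m
alphabet deBruijnFam m = m

okString : (f : Family) (m : ℕ) {l : ℕ} → Vec (Fin (alphabet f m)) l → Bool
okString kautzFam m s = isKautz s
okString deBruijnFam m s = true

Vertex : Family → ℕ → ℕ → Set
Vertex f m k = Σ (Vec (Fin (alphabet f m)) k) (λ s → okString f m s ≡ true)

-- An edge is a (allowed) string s₀…s_{l+1} from s₀…s_l to s₁…s_{l+1};
-- there is at most one such string for given u, v, namely u ∷ʳ last v,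
-- and it exists iff tail u = init v and that string is allowed.
adjCount : (f : Family) (m l : ℕ) → Vertex f m (suc l) → Vertex f m (suc l) → ℕ
adjCount f m l (u , _) (v , _) =
  if ⌊ ≡-dec _≟ᶠ_ (tail u) (init v) ⌋ ∧ okString f m (u ∷ʳ last v) then 1 else 0

Matrix : ℕ → Set
Matrix N = Fin N → Fin N → ℤ

∑ : ∀ {N} → (Fin N → ℤ) → ℤ
∑ {zero} g = + 0
∑ {suc N} g = g Data.Fin.zero + ∑ (λ i → g (Data.Fin.suc i))

∑ℕ : ∀ {N} → (Fin N → ℕ) → ℕ
∑ℕ {zero} g = 0
∑ℕ {suc N} g = g Data.Fin.zero ℕ.+ ∑ℕ (λ i → g (Data.Fin.suc i))

_·_ : ∀ {N} → Matrix N → Matrix N → Matrix N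
(A · B) i j = ∑ (λ k → A i k * B k j)

identity : ∀ {N} → Matrix N
identity i j = if ⌊ i ≟ᶠ j ⌋ then + 1 else + 0

Unimodular : ∀ {N} → Matrix N → Set
Unimodular {N} P = ∃[ P′ ] ((∀ i j → (P · P′) i j ≡ identity i j)
                          × (∀ i j → (P′ · P) i j ≡ identity i j))

IsSmithNormalFormOf : ∀ {N} → Matrix N → Matrix N → Set
IsSmithNormalFormOf {N} S L =
  (∃[ P ] ∃[ Q ] Unimodular P × Unimodular Q
     × (∀ i j → ((P · L) · Q) i j ≡ S i j))
  × (∀ i j → i ≢ j → S i j ≡ + 0)
  × (∀ i → + 0 ℤ.≤ S i i)
  × (∀ i j → toℕ i ℕ.≤ toℕ j → S i i ∣ℤ S j j)

adjMatrix : (f : Family) (m l N : ℕ) → Fin N ⤖ Vertex f m (suc l) → Matrix N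
adjMatrix f m l N e i j = + adjCount f m l (Bijection.to e i) (Bijection.to e j)

outdeg : (f : Family) (m l N : ℕ) → Fin N ⤖ Vertex f m (suc l) → Fin N → ℕ
outdeg f m l N e i = ∑ℕ (λ j → adjCount f m l (Bijection.to e i) (Bijection.to e j))

degMatrix : (f : Family) (m l N : ℕ) → Fin N ⤖ Vertex f m (suc l) → Matrix N
degMatrix f m l N e i j = if ⌊ i ≟ᶠ j ⌋ then + outdeg f m l N e i else + 0

laplacian : (f : Family) (m l N : ℕ) → Fin N ⤖ Vertex f m (suc l) → Matrix N
laplacian f m l N e i j = adjMatrix f m l N e i j - degMatrix f m l N e i j

-- Both graphs are line graphs: a vertex is an allowed word of length n+1 and
-- u → v iff tail u = init v.  Indexing the c allowed words of length n, the
-- adjacency matrix factors as A = B C through 0/1 incidence matrices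
-- B : N × c and C : c × N; every out-degree is m, so L = A − m I ≡ B C (mod m),
-- and B has a left inverse and C a right inverse over ℤ.  For any matrix with
-- such a factorisation modulo m and any Smith form S = P L Q, the matrices
-- X = P B and Y = C Q satisfy S ≡ X Y (mod m) with X, Y of full rank c; a
-- rank bound over ℤ/p, proved by Gaussian elimination, then decides for each
-- prime p ∣ m which invariants p divides, and the regularity S ≡ S W S (mod m)
-- upgrades "divisible by every prime factor of m" to "divisible by m".

module Submission where

open import Defs
open import Data.Nat as ℕ using (ℕ; zero; suc; _≤_; _<_; _/_; NonZero)
open import Data.Nat.Coprimality using (Coprime)
open import Data.Fin using (Fin; toℕ)
open import Data.Integer using (ℤ; +_; ∣_∣)
open import Data.Integer.Divisibility using (_∣_)
open import Data.Product using (_×_)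
open import Function.Bundles using (_⤖_)

open import Axiom.UniquenessOfIdentityProofs using (module Decidable⇒UIP)
open import Data.Bool using (if_then_else_; true)
import Data.Bool.Properties as Bool
open import Data.Empty using (⊥-elim)
open import Data.Fin as Fin using (zero; suc; punchIn; punchOut; inject≤) renaming (_≟_ to _≟ᶠ_)
open import Data.Fin.Permutation using (↔⇒≡)
open import Data.Fin.Properties as Fin using (punchInᵢ≢i; ¬∀⟶∃¬; ¬Fin0)
open import Data.Integer as ℤ using (_+_; _*_; _-_; -_)
open import Data.Integer.Divisibility.Signed as Signed using (divides) renaming (_∣_ to _∣ˢ_)
open import Data.Integer.Properties as ℤ using (+-*-semiring)
open import Data.Integer.Tactic.RingSolver using (solve-∀)
open import Algebra.Properties.Semiring.Sum +-*-semiring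
  using (sum; sum-cong-≗; sum-remove; sum-replicate-zero; ∑-distrib-+; ∑-comm; *-distribˡ-sum; *-distribʳ-sum)
open import Data.List using ([]; _∷_)
open import Data.List.Relation.Unary.All using (_∷_)
import Data.Nat.Divisibility as ℕ
import Data.Nat.Properties as ℕ
open import Data.Nat.Coprimality as Coprime using (coprime-divisor)
open import Data.Nat.DivMod using (m*n/n≡m)
open import Data.Nat.ListAction using (product)
open import Data.Nat.Primality using (Prime; euclidsLemma; ¬prime[1])
open import Data.Nat.Primality.Factorisation using (factorise)
open import Data.Product using (_,_; proj₁; proj₂; ∃)
open import Data.Sum using (inj₁; inj₂)
open import Data.Vec as Vec using (Vec; []; _∷_; tail; init; last; _∷ʳ_; initLast)
open import Data.Vec.Properties as Vec using (≡-dec)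
open import Function using (_∘_; id)
open import Function.Bundles using (mk⤖; Inverse)
open import Function.Properties.Bijection using (⤖⇒↔)
open import Function.Properties.Inverse using (↔-sym; ↔-trans)
open import Level using (0ℓ)
open import Relation.Binary.Bundles using (Setoid)
open import Relation.Binary.PropositionalEquality
  using (_≡_; _≢_; refl; sym; trans; cong; cong₂; subst; subst₂; module ≡-Reasoning)
import Relation.Binary.Reasoning.Setoid
open import Relation.Nullary using (¬_; Dec; yes; no)
open import Relation.Nullary.Decidable using (⌊_⌋)

-- Finite sums.  Defs sums by the same recursion as the library's 'sum' over
-- the semiring ℤ, so we transfer to 'sum' and reuse its algebra.

∑≡sum : ∀ {N} (g : Fin N → ℤ) → ∑ g ≡ sum g
∑≡sum {zero} g = refl
∑≡sum {suc N} g = cong (_+_ (g zero)) (∑≡sum (g ∘ suc))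

∑ℕ≡sum : ∀ {N} (g : Fin N → ℕ) → + ∑ℕ g ≡ sum (λ i → + g i)
∑ℕ≡sum {zero} g = refl
∑ℕ≡sum {suc N} g = trans (ℤ.pos-+ (g zero) _) (cong (_+_ (+ g zero)) (∑ℕ≡sum (g ∘ suc)))

sum-zero : ∀ {N} {g : Fin N → ℤ} → (∀ i → g i ≡ + 0) → sum g ≡ + 0
sum-zero {N} h = trans (sum-cong-≗ h) (sum-replicate-zero N)

sum-ones : ∀ K → sum {K} (λ _ → + 1) ≡ + K
sum-ones zero = refl
sum-ones (suc K) = cong (_+_ (+ 1)) (sum-ones K)

sum-single : ∀ {N} (g : Fin N → ℤ) (k : Fin N) → (∀ i → i ≢ k → g i ≡ + 0) → sum g ≡ g k
sum-single {suc N} g k h = begin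
  sum g                      ≡⟨ sum-remove {i = k} g ⟩
  g k + sum (g ∘ punchIn k)  ≡⟨ cong (_+_ (g k)) (sum-zero (λ i → h (punchIn k i) (punchInᵢ≢i k i))) ⟩
  g k + + 0                  ≡⟨ ℤ.+-identityʳ (g k) ⟩
  g k                        ∎
  where open ≡-Reasoning

sum-linear : ∀ {K} (b c : ℤ) (U V W : Fin K → ℤ) →
  sum (λ k → (b * U k - c * V k) * W k) ≡ b * sum (λ k → U k * W k) - c * sum (λ k → V k * W k)
sum-linear b c U V W = begin
  sum (λ k → (b * U k - c * V k) * W k)                  ≡⟨ sum-cong-≗ (λ k → expand b c (U k) (V k) (W k)) ⟩
  sum (λ k → b * (U k * W k) + (- c) * (V k * W k))      ≡⟨ ∑-distrib-+ (λ k → b * (U k * W k)) (λ k → (- c) * (V k * W k)) ⟩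
  sum (λ k → b * (U k * W k)) + sum (λ k → (- c) * (V k * W k))
    ≡⟨ cong₂ _+_ (sym (*-distribˡ-sum b (λ k → U k * W k))) (sym (*-distribˡ-sum (- c) (λ k → V k * W k))) ⟩
  b * sum (λ k → U k * W k) + (- c) * sum (λ k → V k * W k)
    ≡⟨ cong (_+_ (b * sum (λ k → U k * W k))) (sym (ℤ.neg-distribˡ-* c _)) ⟩
  b * sum (λ k → U k * W k) - c * sum (λ k → V k * W k)  ∎
  where
  open ≡-Reasoning
  expand : ∀ b c u v w → (b * u - c * v) * w ≡ b * (u * w) + (- c) * (v * w)
  expand = solve-∀

Mat : ℕ → ℕ → Set
Mat a b = Fin a → Fin b → ℤ

infixl 7 _⊗_
_⊗_ : ∀ {a b c} → Mat a b → Mat b c → Mat a c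
(A ⊗ B) i j = sum (λ k → A i k * B k j)

infix 4 _≋_
_≋_ : ∀ {a b} → Mat a b → Mat a b → Set
A ≋ B = ∀ i j → A i j ≡ B i j

·≋⊗ : ∀ {N} (A B : Matrix N) → A · B ≋ A ⊗ B
·≋⊗ A B i j = ∑≡sum (λ k → A i k * B k j)

⊗-cong : ∀ {a b c} {A A′ : Mat a b} {B B′ : Mat b c} → A ≋ A′ → B ≋ B′ → A ⊗ B ≋ A′ ⊗ B′
⊗-cong A≋A′ B≋B′ i j = sum-cong-≗ (λ k → cong₂ _*_ (A≋A′ i k) (B≋B′ k j))

⊗-congˡ : ∀ {a b c} (A : Mat a b) {B B′ : Mat b c} → B ≋ B′ → A ⊗ B ≋ A ⊗ B′
⊗-congˡ A = ⊗-cong {A = A} (λ _ _ → refl)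

⊗-congʳ : ∀ {a b c} {A A′ : Mat a b} (B : Mat b c) → A ≋ A′ → A ⊗ B ≋ A′ ⊗ B
⊗-congʳ B A≋A′ = ⊗-cong {B = B} A≋A′ (λ _ _ → refl)

⊗-assoc : ∀ {a b c d} (A : Mat a b) (B : Mat b c) (C : Mat c d) → (A ⊗ B) ⊗ C ≋ A ⊗ (B ⊗ C)
⊗-assoc A B C i j = begin
  sum (λ l → sum (λ k → A i k * B k l) * C l j)  ≡⟨ sum-cong-≗ (λ l → *-distribʳ-sum (C l j) (λ k → A i k * B k l)) ⟩
  sum (λ l → sum (λ k → A i k * B k l * C l j))  ≡⟨ ∑-comm (λ l k → A i k * B k l * C l j) ⟩
  sum (λ k → sum (λ l → A i k * B k l * C l j))  ≡⟨ sum-cong-≗ (λ k → sum-cong-≗ (λ l → ℤ.*-assoc (A i k) (B k l) (C l j))) ⟩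
  sum (λ k → sum (λ l → A i k * (B k l * C l j))) ≡⟨ sum-cong-≗ (λ k → sym (*-distribˡ-sum (A i k) (λ l → B k l * C l j))) ⟩
  sum (λ k → A i k * sum (λ l → B k l * C l j))  ∎
  where open ≡-Reasoning

≋-setoid : ℕ → ℕ → Setoid 0ℓ 0ℓ
≋-setoid a b = record
  { Carrier = Mat a b
  ; _≈_ = _≋_
  ; isEquivalence = record
    { refl = λ i j → refl
    ; sym = λ A≋B i j → sym (A≋B i j)
    ; trans = λ A≋B B≋C i j → trans (A≋B i j) (B≋C i j)
    }
  }

module ≋-Reasoning {a b : ℕ} = Relation.Binary.Reasoning.Setoid (≋-setoid a b)

[_] : ∀ {A : Set} → Dec A → ℤ
[ d ] = if ⌊ d ⌋ then + 1 else + 0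

[]-yes : ∀ {A : Set} (d : Dec A) → A → [ d ] ≡ + 1
[]-yes (yes _) _ = refl
[]-yes (no ¬a) a = ⊥-elim (¬a a)

[]-no : ∀ {A : Set} (d : Dec A) → ¬ A → [ d ] ≡ + 0
[]-no (yes a) ¬a = ⊥-elim (¬a a)
[]-no (no _) _ = refl

-- Diagonal matrices; the identity of Defs is 'diagonal (λ _ → + 1)' by definition.
diagonal : ∀ {a} → (Fin a → ℤ) → Mat a a
diagonal d i j = if ⌊ i ≟ᶠ j ⌋ then d i else + 0

diagonal-on : ∀ {a} (d : Fin a → ℤ) i → diagonal d i i ≡ d i
diagonal-on d i with i ≟ᶠ i
... | yes _ = refl
... | no i≢i = ⊥-elim (i≢i refl)

diagonal-off : ∀ {a} (d : Fin a → ℤ) {i j} → i ≢ j → diagonal d i j ≡ + 0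
diagonal-off d {i} {j} i≢j with i ≟ᶠ j
... | yes i≡j = ⊥-elim (i≢j i≡j)
... | no _ = refl

diagonal-unique : ∀ {a} (D : Mat a a) (d : Fin a → ℤ) →
  (∀ i → D i i ≡ d i) → (∀ i j → i ≢ j → D i j ≡ + 0) → D ≋ diagonal d
diagonal-unique D d on off i j with i ≟ᶠ j
... | yes refl = on i
... | no i≢j = off i j i≢j

diagonal-restrict : ∀ {a b} (d : Fin b → ℤ) (g : Fin a → Fin b) → (∀ {i j} → g i ≡ g j → i ≡ j) →
  (λ i j → diagonal d (g i) (g j)) ≋ diagonal (d ∘ g)
diagonal-restrict d g g-inj = diagonal-unique _ (d ∘ g)
  (λ i → diagonal-on d (g i)) (λ i j i≢j → diagonal-off d (i≢j ∘ g-inj))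

diagonal-scale : ∀ {a} (b : ℤ) (d : Fin a → ℤ) → (λ i j → b * diagonal d i j) ≋ diagonal (λ i → b * d i)
diagonal-scale b d = diagonal-unique _ (λ i → b * d i)
  (λ i → cong (b *_) (diagonal-on d i)) (λ i j i≢j → trans (cong (b *_) (diagonal-off d i≢j)) (ℤ.*-zeroʳ b))

⊗-diagonalʳ : ∀ {a b} (A : Mat a b) (d : Fin b → ℤ) i k → (A ⊗ diagonal d) i k ≡ A i k * d k
⊗-diagonalʳ A d i k = trans
  (sum-single (λ l → A i l * diagonal d l k) k (λ l l≢k → trans (cong (A i l *_) (diagonal-off d l≢k)) (ℤ.*-zeroʳ (A i l))))
  (cong (A i k *_) (diagonal-on d k))

⊗-diagonalˡ : ∀ {a b} (d : Fin a → ℤ) (A : Mat a b) k j → (diagonal d ⊗ A) k j ≡ d k * A k j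
⊗-diagonalˡ d A k j = trans
  (sum-single (λ l → diagonal d k l * A l j) k (λ l l≢k → trans (cong (_* A l j) (diagonal-off d (l≢k ∘ sym))) (ℤ.*-zeroˡ (A l j))))
  (cong (_* A k j) (diagonal-on d k))

⊗-identityʳ : ∀ {a b} (A : Mat a b) → A ⊗ identity ≋ A
⊗-identityʳ A i j = trans (⊗-diagonalʳ A (λ _ → + 1) i j) (ℤ.*-identityʳ (A i j))

⊗-identityˡ : ∀ {a b} (A : Mat a b) → identity ⊗ A ≋ A
⊗-identityˡ A i j = trans (⊗-diagonalˡ (λ _ → + 1) A i j) (ℤ.*-identityˡ (A i j))

⊗-cancel-middle : ∀ {a b c d} (A : Mat a b) {U : Mat b c} {V : Mat c b} (D : Mat b d) →
  U ⊗ V ≋ identity → (A ⊗ U) ⊗ (V ⊗ D) ≋ A ⊗ D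
⊗-cancel-middle A {U} {V} D UV≋I = begin
  (A ⊗ U) ⊗ (V ⊗ D)   ≈⟨ ⊗-assoc A U (V ⊗ D) ⟩
  A ⊗ (U ⊗ (V ⊗ D))   ≈⟨ ⊗-congˡ A (⊗-assoc U V D) ⟨
  A ⊗ ((U ⊗ V) ⊗ D)   ≈⟨ ⊗-congˡ A (⊗-congʳ D UV≋I) ⟩
  A ⊗ (identity ⊗ D)  ≈⟨ ⊗-congˡ A (⊗-identityˡ D) ⟩
  A ⊗ D               ∎
  where open ≋-Reasoning

-- Summing the indicator b of the image of an injection h : Fin K → Fin N gives K:
-- b j counts the a with h a = j, and exchanging the two sums counts each a once.
sum-image : ∀ {N K} (b : Fin N → ℤ) (h : Fin K → Fin N) → (∀ {a a′} → h a ≡ h a′ → a ≡ a′) →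
  (∀ a → b (h a) ≡ + 1) → (∀ j → (∀ a → h a ≢ j) → b j ≡ + 0) → sum b ≡ + K
sum-image {K = K} b h h-injective on-image off-image = begin
  sum b                                     ≡⟨ sum-cong-≗ b≡fibre ⟩
  sum (λ j → sum (λ a → identity (h a) j))  ≡⟨ ∑-comm (λ j a → identity (h a) j) ⟩
  sum (λ a → sum (λ j → identity (h a) j))  ≡⟨ sum-cong-≗ row-sum ⟩
  sum {K} (λ _ → + 1)                       ≡⟨ sum-ones K ⟩
  + K                                       ∎
  where
  open ≡-Reasoning
  row-sum : ∀ a → sum (λ j → identity (h a) j) ≡ + 1
  row-sum a = trans (sum-single _ (h a) (λ j j≢ha → diagonal-off _ (j≢ha ∘ sym))) (diagonal-on _ (h a))
  fibre-single : ∀ a₀ a → a ≢ a₀ → identity (h a) (h a₀) ≡ + 0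
  fibre-single a₀ a a≢a₀ = diagonal-off _ (a≢a₀ ∘ h-injective)
  b≡fibre : ∀ j → b j ≡ sum (λ a → identity (h a) j)
  b≡fibre j with Fin.any? (λ a → h a ≟ᶠ j)
  ... | yes (a₀ , refl) = trans (on-image a₀)
          (sym (trans (sum-single _ a₀ (fibre-single a₀)) (diagonal-on _ (h a₀))))
  ... | no ∄a = trans (off-image j (λ a ha≡j → ∄a (a , ha≡j)))
          (sym (sum-zero (λ a → diagonal-off _ (λ ha≡j → ∄a (a , ha≡j)))))

infix 4 _≡_mod_
record _≡_mod_ (x y p : ℤ) : Set where
  constructor congruent
  field divides-difference : p ∣ˢ x - y

open _≡_mod_

module _ {p : ℤ} where

  ≡⇒mod : ∀ {x y} → x ≡ y → x ≡ y mod p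
  ≡⇒mod {x} refl = congruent (subst (p ∣ˢ_) (sym (ℤ.+-inverseʳ x)) (divides (+ 0) (sym (ℤ.*-zeroˡ p))))

  mod-refl : ∀ {x} → x ≡ x mod p
  mod-refl = ≡⇒mod refl

  mod-sym : ∀ {x y} → x ≡ y mod p → y ≡ x mod p
  mod-sym {x} {y} (congruent d) = congruent (subst (p ∣ˢ_) (negate x y) (Signed.∣m⇒∣-m d))
    where
    negate : ∀ x y → - (x - y) ≡ y - x
    negate = solve-∀

  mod-trans : ∀ {x y z} → x ≡ y mod p → y ≡ z mod p → x ≡ z mod p
  mod-trans {x} {y} {z} (congruent d) (congruent d′) = congruent (subst (p ∣ˢ_) (telescope x y z) (Signed.∣m∣n⇒∣m+n d d′))
    where
    telescope : ∀ x y z → (x - y) + (y - z) ≡ x - z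
    telescope = solve-∀

  mod-+ : ∀ {x x′ y y′} → x ≡ x′ mod p → y ≡ y′ mod p → x + y ≡ x′ + y′ mod p
  mod-+ {x} {x′} {y} {y′} (congruent d) (congruent d′) = congruent (subst (p ∣ˢ_) (regroup x x′ y y′) (Signed.∣m∣n⇒∣m+n d d′))
    where
    regroup : ∀ x x′ y y′ → (x - x′) + (y - y′) ≡ (x + y) - (x′ + y′)
    regroup = solve-∀

  mod-− : ∀ {x x′ y y′} → x ≡ x′ mod p → y ≡ y′ mod p → x - y ≡ x′ - y′ mod p
  mod-− {x} {x′} {y} {y′} (congruent d) (congruent d′) = congruent (subst (p ∣ˢ_) (regroup x x′ y y′) (Signed.∣m∣n⇒∣m-n d d′))
    where
    regroup : ∀ x x′ y y′ → (x - x′) - (y - y′) ≡ (x - y) - (x′ - y′)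
    regroup = solve-∀

  mod-*ˡ : ∀ c {x y} → x ≡ y mod p → c * x ≡ c * y mod p
  mod-*ˡ c {x} {y} (congruent d) = congruent (subst (p ∣ˢ_) (distrib c x y) (Signed.∣n⇒∣m*n c d))
    where
    distrib : ∀ c x y → c * (x - y) ≡ c * x - c * y
    distrib = solve-∀

  mod-*ʳ : ∀ c {x y} → x ≡ y mod p → x * c ≡ y * c mod p
  mod-*ʳ c {x} {y} x≡y = subst₂ (_≡_mod p) (ℤ.*-comm c x) (ℤ.*-comm c y) (mod-*ˡ c x≡y)

  mod-* : ∀ {x x′ y y′} → x ≡ x′ mod p → y ≡ y′ mod p → x * y ≡ x′ * y′ mod p
  mod-* {x′ = x′} {y = y} x≡x′ y≡y′ = mod-trans (mod-*ʳ y x≡x′) (mod-*ˡ x′ y≡y′)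

  mod-sum : ∀ {N} {g h : Fin N → ℤ} → (∀ i → g i ≡ h i mod p) → sum g ≡ sum h mod p
  mod-sum {zero} _ = mod-refl
  mod-sum {suc N} g≡h = mod-+ (g≡h zero) (mod-sum (g≡h ∘ suc))

  mod-0⇒∣ : ∀ {x} → x ≡ + 0 mod p → p ∣ˢ x
  mod-0⇒∣ {x} (congruent d) = subst (p ∣ˢ_) (ℤ.+-identityʳ x) d

  ∣⇒mod-0 : ∀ {x} → p ∣ˢ x → x ≡ + 0 mod p
  ∣⇒mod-0 {x} d = congruent (subst (p ∣ˢ_) (sym (ℤ.+-identityʳ x)) d)

  sum-divisible : ∀ {N} (g : Fin N → ℤ) → (∀ i → p ∣ˢ g i) → p ∣ˢ sum g
  sum-divisible {N} g p∣g = mod-0⇒∣ (mod-trans (mod-sum (∣⇒mod-0 ∘ p∣g)) (≡⇒mod (sum-replicate-zero N)))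

  modSetoid : Setoid 0ℓ 0ℓ
  modSetoid = record
    { Carrier = ℤ
    ; _≈_ = _≡_mod p
    ; isEquivalence = record { refl = mod-refl ; sym = mod-sym ; trans = mod-trans }
    }

module ModReasoning (p : ℤ) = Relation.Binary.Reasoning.Setoid (modSetoid {p})

mod-divisor : ∀ {p q x y} → q ∣ˢ p → x ≡ y mod p → x ≡ y mod q
mod-divisor q∣p (congruent d) = congruent (Signed.∣-trans q∣p d)

infix 4 _≋_mod_
_≋_mod_ : ∀ {a b} → Mat a b → Mat a b → ℤ → Set
A ≋ B mod p = ∀ i j → A i j ≡ B i j mod p

≋⇒mod : ∀ {a b p} {A B : Mat a b} → A ≋ B → A ≋ B mod p
≋⇒mod A≋B i j = ≡⇒mod (A≋B i j)

⊗-cong-mod : ∀ {a b c p} {A A′ : Mat a b} {B B′ : Mat b c} →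
  A ≋ A′ mod p → B ≋ B′ mod p → A ⊗ B ≋ A′ ⊗ B′ mod p
⊗-cong-mod A≡A′ B≡B′ i j = mod-sum (λ k → mod-* (A≡A′ i k) (B≡B′ k j))

⊗-congˡ-mod : ∀ {a b c p} (A : Mat a b) {B B′ : Mat b c} → B ≋ B′ mod p → A ⊗ B ≋ A ⊗ B′ mod p
⊗-congˡ-mod A = ⊗-cong-mod {A = A} (λ _ _ → mod-refl)

⊗-congʳ-mod : ∀ {a b c p} {A A′ : Mat a b} (B : Mat b c) → A ≋ A′ mod p → A ⊗ B ≋ A′ ⊗ B mod p
⊗-congʳ-mod B A≡A′ = ⊗-cong-mod {B = B} A≡A′ (λ _ _ → mod-refl)

matModSetoid : ℕ → ℕ → ℤ → Setoid 0ℓ 0ℓ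
matModSetoid a b p = record
  { Carrier = Mat a b
  ; _≈_ = _≋_mod p
  ; isEquivalence = record
    { refl = λ i j → mod-refl
    ; sym = λ A≡B i j → mod-sym (A≡B i j)
    ; trans = λ A≡B B≡C i j → mod-trans (A≡B i j) (B≡C i j)
    }
  }

module MatModReasoning {a b : ℕ} (p : ℤ) = Relation.Binary.Reasoning.Setoid (matModSetoid a b p)

sum-truncate : ∀ {p N} (g : Fin N → ℤ) j .(j≤N : j ≤ N) → (∀ i → j ≤ toℕ i → g i ≡ + 0 mod p) →
  sum g ≡ sum {j} (λ i → g (inject≤ i j≤N)) mod p
sum-truncate {N = zero} g zero _ _ = mod-refl
sum-truncate {N = suc N} g zero _ g≡0 = mod-trans (mod-sum (λ i → g≡0 i ℕ.z≤n)) (≡⇒mod (sum-replicate-zero (suc N)))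
sum-truncate {N = suc N} g (suc j) j≤N g≡0 =
  mod-+ (mod-refl {x = g zero}) (sum-truncate (g ∘ suc) j (ℕ.≤-pred j≤N) (λ i j≤i → g≡0 (suc i) (ℕ.s≤s j≤i)))

prime-factor : ∀ d → d ≢ 0 → d ≢ 1 → ∃ λ p → Prime p × p ℕ.∣ d
prime-factor zero d≢0 _ = ⊥-elim (d≢0 refl)
prime-factor (suc d) _ d≢1 with factorise (suc d)
... | record { factors = [] ; isFactorisation = d≡1 } = ⊥-elim (d≢1 d≡1)
... | record { factors = p ∷ ps ; isFactorisation = d≡Πfactors ; factorsPrime = prime[p] ∷ _ } =
  p , prime[p] , subst (p ℕ.∣_) (sym d≡Πfactors) (ℕ.m∣m*n (product ps))

coprime-by-primes : ∀ a m → m ≢ 0 → (∀ p → Prime p → p ℕ.∣ m → ¬ (p ℕ.∣ a)) → Coprime a m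
coprime-by-primes a m m≢0 no-common-prime {d} (d∣a , d∣m) with d ℕ.≟ 1
... | yes d≡1 = d≡1
... | no d≢1 with prime-factor d (λ { refl → m≢0 (ℕ.0∣⇒≡0 d∣m) }) d≢1
...   | p , prime[p] , p∣d = ⊥-elim (no-common-prime p prime[p] (ℕ.∣-trans p∣d d∣m) (ℕ.∣-trans p∣d d∣a))

prime∤* : ∀ {p} → Prime p → ∀ {a b} → ¬ (+ p ∣ˢ a) → ¬ (+ p ∣ˢ b) → ¬ (+ p ∣ˢ a * b)
prime∤* {p} pr {a} {b} p∤a p∤b p∣ab
  with euclidsLemma ∣ a ∣ ∣ b ∣ pr (subst (p ℕ.∣_) (ℤ.abs-* a b) (Signed.∣⇒∣ᵤ p∣ab))
... | inj₁ p∣a = p∤a (Signed.∣ᵤ⇒∣ p∣a)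
... | inj₂ p∣b = p∤b (Signed.∣ᵤ⇒∣ p∣b)

prime∤1 : ∀ {p} → Prime p → ¬ (+ p ∣ˢ + 1)
prime∤1 pr p∣1 = ¬prime[1] (subst Prime (ℕ.∣1⇒≡1 (Signed.∣⇒∣ᵤ p∣1)) pr)

eliminateRows : ∀ {r K} → Mat (suc r) (suc K) → Fin (suc K) → Mat r K
eliminateRows M k₀ i k = M zero k₀ * M (suc i) (punchIn k₀ k) - M (suc i) k₀ * M zero (punchIn k₀ k)

deletePivot : ∀ {r K} → Mat (suc K) (suc r) → Fin (suc K) → Mat K r
deletePivot Z k₀ k j = Z (punchIn k₀ k) (suc j)

-- The eliminated product is the same row combination of M ⊗ Z (exactly, over ℤ):
-- the deleted column contributes (b·M(i+1)k₀ − M(i+1)k₀·b)·Z = 0.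
eliminate-⊗ : ∀ {r K} (M : Mat (suc r) (suc K)) (Z : Mat (suc K) (suc r)) k₀ i j →
  (eliminateRows M k₀ ⊗ deletePivot Z k₀) i j ≡
  M zero k₀ * (M ⊗ Z) (suc i) (suc j) - M (suc i) k₀ * (M ⊗ Z) zero (suc j)
eliminate-⊗ {K = K} M Z k₀ i j = begin
  sum (F ∘ punchIn k₀)          ≡⟨ sym (ℤ.+-identityˡ _) ⟩
  + 0 + sum (F ∘ punchIn k₀)    ≡⟨ cong (_+ sum (F ∘ punchIn k₀)) (sym (cancel b c (Z k₀ (suc j)))) ⟩
  F k₀ + sum (F ∘ punchIn k₀)   ≡⟨ sym (sum-remove {i = k₀} F) ⟩
  sum F                         ≡⟨ sum-linear b c (M (suc i)) (M zero) (λ k → Z k (suc j)) ⟩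
  b * (M ⊗ Z) (suc i) (suc j) - c * (M ⊗ Z) zero (suc j) ∎
  where
  open ≡-Reasoning
  b c : ℤ
  b = M zero k₀
  c = M (suc i) k₀
  F : Fin (suc K) → ℤ
  F k = (b * M (suc i) k - c * M zero k) * Z k (suc j)
  cancel : ∀ b c z → (b * c - c * b) * z ≡ + 0
  cancel = solve-∀

module _ {p : ℕ} (pr : Prime p) where

  pivot : ∀ {r K} (d : Fin (suc r) → ℤ) → ¬ (+ p ∣ˢ d zero) → (M : Mat (suc r) K) (Z : Mat K (suc r)) →
    diagonal d ≋ M ⊗ Z mod + p → ∃ λ k → ¬ (+ p ∣ˢ M zero k)
  pivot {K = K} d p∤d₀ M Z d≡MZ =
    ¬∀⟶∃¬ K (λ k → + p ∣ˢ M zero k) (λ k → + p Signed.∣? M zero k) λ p∣row →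
      p∤d₀ (mod-0⇒∣ (mod-trans (subst (_≡ (M ⊗ Z) zero zero mod + p) (diagonal-on d zero) (d≡MZ zero zero))
                               (∣⇒mod-0 (sum-divisible _ (λ k → Signed.∣m⇒∣m*n (Z k zero) (p∣row k))))))

  -- Induction on r by eliminating the first row at a pivot; the new
  -- diagonal is b·d(i+1).
  rank-bound : ∀ {r K} (d : Fin r → ℤ) → (∀ i → ¬ (+ p ∣ˢ d i)) → (M : Mat r K) (Z : Mat K r) →
    diagonal d ≋ M ⊗ Z mod + p → r ≤ K
  rank-bound {zero} _ _ _ _ _ = ℕ.z≤n
  rank-bound {suc r} {zero} d p∤d M Z d≡MZ = ⊥-elim (¬Fin0 (proj₁ (pivot d (p∤d zero) M Z d≡MZ)))
  rank-bound {suc r} {suc K} d p∤d M Z d≡MZ =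
    ℕ.s≤s (rank-bound d′ p∤d′ (eliminateRows M k₀) (deletePivot Z k₀) d′≡M′Z′)
    where
    k₀ : Fin (suc K)
    k₀ = proj₁ (pivot d (p∤d zero) M Z d≡MZ)
    b : ℤ
    b = M zero k₀
    c : Fin r → ℤ
    c i = M (suc i) k₀
    d′ : Fin r → ℤ
    d′ i = b * d (suc i)
    p∤d′ : ∀ i → ¬ (+ p ∣ˢ d′ i)
    p∤d′ i = prime∤* pr (proj₂ (pivot d (p∤d zero) M Z d≡MZ)) (p∤d (suc i))
    d′≡M′Z′ : diagonal d′ ≋ eliminateRows M k₀ ⊗ deletePivot Z k₀ mod + p
    d′≡M′Z′ i j = begin
      diagonal d′ i j                                         ≡⟨ sym (diagonal-scale b (d ∘ suc) i j) ⟩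
      b * diagonal (d ∘ suc) i j                              ≡⟨ cong (b *_) (sym (diagonal-restrict d suc Fin.suc-injective i j)) ⟩
      b * diagonal d (suc i) (suc j)                          ≡⟨ minus-zero (b * diagonal d (suc i) (suc j)) (c i) ⟩
      b * diagonal d (suc i) (suc j) - c i * diagonal d zero (suc j)
        ≈⟨ mod-− (mod-*ˡ b (d≡MZ (suc i) (suc j))) (mod-*ˡ (c i) (d≡MZ zero (suc j))) ⟩
      b * (M ⊗ Z) (suc i) (suc j) - c i * (M ⊗ Z) zero (suc j) ≡⟨ sym (eliminate-⊗ M Z k₀ i j) ⟩
      (eliminateRows M k₀ ⊗ deletePivot Z k₀) i j            ∎
      where
      open ModReasoning (+ p)
      minus-zero : ∀ x y → x ≡ x - y * + 0
      minus-zero = solve-∀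

-- With X = P B, Y = C Q, Y′ = R P′, X′ = Q′ T we have S ≡ X Y (mod m),
-- Y′ X = I = Y X′.  For a prime p ∣ m this gives, over ℤ/p,
--  * I_c ≡ Y′ S X′: if p ∣ s_j with j < c, then p divides all later s_i, so
--    I_c factors through j < c dimensions, contradicting the rank bound;
--  * if p ∤ s_i with i ≥ c, then p divides none of s_0 … s_c (they divide
--    s_i), yet the leading (c+1)-block of S ≡ X Y factors through c
--    dimensions, again contradicting the rank bound;
-- and S ≡ S (X′ Y′) S gives m ∣ (1 − s_i w_i) s_i, where 1 − s_i w_i is prime
-- to m once every prime factor of m divides s_i.
module SmithInvariants
  (m : ℕ) .{{_ : NonZero m}} {N c : ℕ}
  (L : Matrix N) (B : Mat N c) (C : Mat c N) (R : Mat c N) (T : Mat N c)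
  (L≡BC : L ≋ B ⊗ C mod + m) (RB≋I : R ⊗ B ≋ identity) (CT≋I : C ⊗ T ≋ identity)
  (S P Q P′ Q′ : Matrix N) (P′P≋I : P′ ⊗ P ≋ identity) (QQ′≋I : Q ⊗ Q′ ≋ identity)
  (PLQ≋S : (P ⊗ L) ⊗ Q ≋ S) (S-off : ∀ i j → i ≢ j → S i j ≡ + 0)
  (S-chain : ∀ i j → toℕ i ≤ toℕ j → S i i ∣ S j j)
  where

  s : Fin N → ℤ
  s i = S i i

  X : Mat N c
  X = P ⊗ B

  Y : Mat c N
  Y = C ⊗ Q

  Y′ : Mat c N
  Y′ = R ⊗ P′

  X′ : Mat N c
  X′ = Q′ ⊗ T

  S≋diagonal : S ≋ diagonal s
  S≋diagonal = diagonal-unique S s (λ _ → refl) S-off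

  Y′X≋I : Y′ ⊗ X ≋ identity
  Y′X≋I i j = trans (⊗-cancel-middle R {P′} {P} B P′P≋I i j) (RB≋I i j)

  YX′≋I : Y ⊗ X′ ≋ identity
  YX′≋I i j = trans (⊗-cancel-middle C {Q} {Q′} T QQ′≋I i j) (CT≋I i j)

  S≡XY : S ≋ X ⊗ Y mod + m
  S≡XY = begin
    S                  ≈⟨ ≋⇒mod PLQ≋S ⟨
    (P ⊗ L) ⊗ Q        ≈⟨ ⊗-congʳ-mod Q (⊗-congˡ-mod P L≡BC) ⟩
    (P ⊗ (B ⊗ C)) ⊗ Q  ≈⟨ ≋⇒mod (⊗-congʳ Q (⊗-assoc P B C)) ⟨
    ((P ⊗ B) ⊗ C) ⊗ Q  ≈⟨ ≋⇒mod (⊗-assoc X C Q) ⟩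
    X ⊗ Y              ∎
    where open MatModReasoning (+ m)

  X≡SX′ : X ≋ S ⊗ X′ mod + m
  X≡SX′ = begin
    X              ≈⟨ ≋⇒mod (⊗-identityʳ X) ⟨
    X ⊗ identity   ≈⟨ ≋⇒mod (⊗-congˡ X YX′≋I) ⟨
    X ⊗ (Y ⊗ X′)   ≈⟨ ≋⇒mod (⊗-assoc X Y X′) ⟨
    (X ⊗ Y) ⊗ X′   ≈⟨ ⊗-congʳ-mod X′ S≡XY ⟨
    S ⊗ X′         ∎
    where open MatModReasoning (+ m)

  Y≡Y′S : Y ≋ Y′ ⊗ S mod + m
  Y≡Y′S = begin
    Y              ≈⟨ ≋⇒mod (⊗-identityˡ Y) ⟨
    identity ⊗ Y   ≈⟨ ≋⇒mod (⊗-congʳ Y Y′X≋I) ⟨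
    (Y′ ⊗ X) ⊗ Y   ≈⟨ ≋⇒mod (⊗-assoc Y′ X Y) ⟩
    Y′ ⊗ (X ⊗ Y)   ≈⟨ ⊗-congˡ-mod Y′ S≡XY ⟨
    Y′ ⊗ S         ∎
    where open MatModReasoning (+ m)

  W : Matrix N
  W = X′ ⊗ Y′

  S≡SWS : S ≋ (S ⊗ W) ⊗ S mod + m
  S≡SWS = begin
    S                   ≈⟨ S≡XY ⟩
    X ⊗ Y               ≈⟨ ⊗-cong-mod X≡SX′ Y≡Y′S ⟩
    (S ⊗ X′) ⊗ (Y′ ⊗ S) ≈⟨ ≋⇒mod (⊗-assoc (S ⊗ X′) Y′ S) ⟨
    ((S ⊗ X′) ⊗ Y′) ⊗ S ≈⟨ ≋⇒mod (⊗-congʳ S (⊗-assoc S X′ Y′)) ⟩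
    (S ⊗ W) ⊗ S         ∎
    where open MatModReasoning (+ m)

  Y′SX′≡I : (Y′ ⊗ S) ⊗ X′ ≋ identity mod + m
  Y′SX′≡I = begin
    (Y′ ⊗ S) ⊗ X′        ≈⟨ ⊗-congʳ-mod X′ (⊗-congˡ-mod Y′ S≡XY) ⟩
    (Y′ ⊗ (X ⊗ Y)) ⊗ X′  ≈⟨ ≋⇒mod (⊗-congʳ X′ (⊗-assoc Y′ X Y)) ⟨
    ((Y′ ⊗ X) ⊗ Y) ⊗ X′  ≈⟨ ≋⇒mod (⊗-assoc (Y′ ⊗ X) Y X′) ⟩
    (Y′ ⊗ X) ⊗ (Y ⊗ X′)  ≈⟨ ≋⇒mod (⊗-cong Y′X≋I YX′≋I) ⟩
    identity ⊗ identity  ≈⟨ ≋⇒mod (⊗-identityˡ identity) ⟩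
    identity             ∎
    where open MatModReasoning (+ m)

  divisible-later : ∀ {p} (j i : Fin N) → toℕ j ≤ toℕ i → + p ∣ˢ s j → + p ∣ˢ s i
  divisible-later j i j≤i p∣sⱼ = Signed.∣-trans p∣sⱼ (Signed.∣ᵤ⇒∣ {s j} {s i} (S-chain j i j≤i))

  ∣-pos : ∀ {p} → p ℕ.∣ m → + p ∣ˢ + m
  ∣-pos {p} p∣m = Signed.∣ᵤ⇒∣ {+ p} {+ m} p∣m

  unit-below : ∀ {p} → Prime p → p ℕ.∣ m → (j : Fin N) → toℕ j < c → ¬ (+ p ∣ˢ s j)
  unit-below {p} pr p∣m j j<c p∣sⱼ = ℕ.<⇒≱ j<c (rank-bound pr (λ _ → + 1) (λ _ → prime∤1 pr) M′ Z′ I≡M′Z′)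
    where
    j≤N : toℕ j ≤ N
    j≤N = ℕ.<⇒≤ (Fin.toℕ<n j)
    lead : Fin (toℕ j) → Fin N
    lead i = inject≤ i j≤N
    M′ : Mat c (toℕ j)
    M′ a i = Y′ a (lead i) * s (lead i)
    Z′ : Mat (toℕ j) c
    Z′ i b = X′ (lead i) b
    tail≡0 : ∀ a b i → toℕ j ≤ toℕ i → Y′ a i * s i * X′ i b ≡ + 0 mod + p
    tail≡0 a b i j≤i = ∣⇒mod-0 (Signed.∣m⇒∣m*n (X′ i b) (Signed.∣n⇒∣m*n (Y′ a i) (divisible-later j i j≤i p∣sⱼ)))
    I≡M′Z′ : identity ≋ M′ ⊗ Z′ mod + p
    I≡M′Z′ a b = begin
      identity a b                          ≈⟨ mod-sym (mod-divisor (∣-pos p∣m) (Y′SX′≡I a b)) ⟩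
      ((Y′ ⊗ S) ⊗ X′) a b                   ≡⟨ sum-cong-≗ (λ i → cong (_* X′ i b)
                                                 (trans (⊗-congˡ Y′ S≋diagonal a i) (⊗-diagonalʳ Y′ s a i))) ⟩
      sum (λ i → Y′ a i * s i * X′ i b)     ≈⟨ sum-truncate _ (toℕ j) j≤N (tail≡0 a b) ⟩
      (M′ ⊗ Z′) a b                         ∎
      where open ModReasoning (+ p)

  divisible-above : ∀ {p} → Prime p → p ℕ.∣ m → (i : Fin N) → c ≤ toℕ i → + p ∣ˢ s i
  divisible-above {p} pr p∣m i c≤i with + p Signed.∣? s i
  ... | yes p∣sᵢ = p∣sᵢ
  ... | no p∤sᵢ = ⊥-elim (ℕ.1+n≰n (rank-bound pr (s ∘ lead) p∤lead (X ∘ lead) (λ k b → Y k (lead b)) block≡XY))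
    where
    c<N : suc c ≤ N
    c<N = ℕ.≤-<-trans c≤i (Fin.toℕ<n i)
    lead : Fin (suc c) → Fin N
    lead a = inject≤ a c<N
    lead≤i : ∀ a → toℕ (lead a) ≤ toℕ i
    lead≤i a = subst (_≤ toℕ i) (sym (Fin.toℕ-inject≤ a c<N)) (ℕ.≤-trans (ℕ.s≤s⁻¹ (Fin.toℕ<n a)) c≤i)
    p∤lead : ∀ a → ¬ (+ p ∣ˢ s (lead a))
    p∤lead a p∣s = p∤sᵢ (divisible-later (lead a) i (lead≤i a) p∣s)
    block≡XY : diagonal (s ∘ lead) ≋ (X ∘ lead) ⊗ (λ k b → Y k (lead b)) mod + p
    block≡XY a b = begin
      diagonal (s ∘ lead) a b       ≡⟨ sym (diagonal-restrict s lead (Fin.inject≤-injective c<N c<N _ _) a b) ⟩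
      diagonal s (lead a) (lead b)  ≡⟨ sym (S≋diagonal (lead a) (lead b)) ⟩
      S (lead a) (lead b)           ≈⟨ mod-divisor (∣-pos p∣m) (S≡XY (lead a) (lead b)) ⟩
      (X ⊗ Y) (lead a) (lead b)     ∎
      where open ModReasoning (+ p)

  invariants : ∀ i → (toℕ i < c → Coprime ∣ s i ∣ m) × (c ≤ toℕ i → + m ∣ s i)
  invariants i = prime-to-m , divisible-by-m
    where
    prime-to-m : toℕ i < c → Coprime ∣ s i ∣ m
    prime-to-m i<c = coprime-by-primes ∣ s i ∣ m (ℕ.≢-nonZero⁻¹ m)
      (λ p pr p∣m p∣sᵢ → unit-below pr p∣m i i<c (Signed.∣ᵤ⇒∣ {+ p} {s i} p∣sᵢ))

    -- m ∣ (1 − s w) s by regularity, and 1 − s w is prime to m.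
    divisible-by-m : c ≤ toℕ i → + m ∣ s i
    divisible-by-m c≤i = coprime-divisor (Coprime.sym u-coprime) (subst (m ℕ.∣_) (ℤ.abs-* u (s i)) (Signed.∣⇒∣ᵤ m∣us))
      where
      w = W i i
      u = + 1 - s i * w
      regular : s i ≡ s i * w * s i mod + m
      regular = mod-trans (S≡SWS i i) (≡⇒mod (trans (⊗-congˡ (S ⊗ W) S≋diagonal i i)
                  (trans (⊗-diagonalʳ (S ⊗ W) s i i) (cong (_* s i) (trans (⊗-congʳ W S≋diagonal i i) (⊗-diagonalˡ s W i i))))))
      m∣us : + m ∣ˢ u * s i
      m∣us = subst (+ m ∣ˢ_) (factor (s i) w) (divides-difference regular)
        where
        factor : ∀ s w → s - s * w * s ≡ (+ 1 - s * w) * s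
        factor = solve-∀
      u-coprime : Coprime ∣ u ∣ m
      u-coprime = coprime-by-primes ∣ u ∣ m (ℕ.≢-nonZero⁻¹ m) λ p pr p∣m p∣u →
        prime∤1 pr (subst (+ p ∣ˢ_) (cancel (s i) w)
          (Signed.∣m∣n⇒∣m+n (Signed.∣ᵤ⇒∣ {+ p} {u} p∣u) (Signed.∣m⇒∣m*n w (divisible-above pr p∣m i c≤i))))
        where
        cancel : ∀ s w → (+ 1 - s * w) + s * w ≡ + 1
        cancel = solve-∀

smith-invariants : ∀ (m : ℕ) .{{_ : NonZero m}} {N c} (L : Matrix N) (B : Mat N c) (C R : Mat c N) (T : Mat N c) →
  L ≋ B ⊗ C mod + m → R ⊗ B ≋ identity → C ⊗ T ≋ identity →
  (S : Matrix N) → IsSmithNormalFormOf S L →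
  ∀ i → (toℕ i < c → Coprime ∣ S i i ∣ m) × (c ≤ toℕ i → + m ∣ S i i)
smith-invariants m L B C R T L≡BC RB≋I CT≋I S
  ((P , Q , (P′ , _ , P′P≡I) , (Q′ , QQ′≡I , _) , PLQ≡S) , S-off , _ , S-chain) =
  SmithInvariants.invariants m L B C R T L≡BC RB≋I CT≋I S P Q P′ Q′
    (λ i j → trans (sym (·≋⊗ P′ P i j)) (P′P≡I i j))
    (λ i j → trans (sym (·≋⊗ Q Q′ i j)) (QQ′≡I i j))
    (λ i j → trans (sym (trans (·≋⊗ (P · L) Q i j) (⊗-congʳ Q (·≋⊗ P L) i j))) (PLQ≡S i j))
    S-off S-chain

Word : Family → ℕ → ℕ → Set
Word f m k = Vec (Fin (alphabet f m)) k

Allowed : (f : Family) (m : ℕ) {k : ℕ} → Word f m k → Set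
Allowed f m w = okString f m w ≡ true

vertex-≡ : ∀ {f m k} {u v : Vertex f m k} → proj₁ u ≡ proj₁ v → u ≡ v
vertex-≡ {u = w , p} {v = .w , q} refl = cong (w ,_) (Decidable⇒UIP.≡-irrelevant Bool._≟_ p q)

-- The a-th letter that may stand next to y: any letter other than y in a Kautz
-- word (enumerated by punchIn y), any letter at all in a de Bruijn word.
neighbour : (f : Family) (m : ℕ) → Fin m → Fin (alphabet f m) → Fin (alphabet f m)
neighbour kautzFam m a y = punchIn y a
neighbour deBruijnFam m a y = a

neighbour-injective : ∀ f m y {a b} → neighbour f m a y ≡ neighbour f m b y → a ≡ b
neighbour-injective kautzFam m y = Fin.punchIn-injective y _ _
neighbour-injective deBruijnFam m y = id

-- The letters allowed immediately before y, or immediately after y, are exactly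
-- its neighbours; these four facts are the only family-specific ones.
allowed-cons : ∀ f m {k} a y (s : Word f m k) → Allowed f m (y ∷ s) → Allowed f m (neighbour f m a y ∷ y ∷ s)
allowed-cons kautzFam m a y s ok with punchIn y a ≟ᶠ y
... | yes a≡y = ⊥-elim (punchInᵢ≢i y a a≡y)
... | no _ = ok
allowed-cons deBruijnFam m a y s ok = refl

allowed-cons⁻¹ : ∀ f m {k} x y (s : Word f m k) → Allowed f m (x ∷ y ∷ s) →
  Allowed f m (y ∷ s) × ∃ λ a → neighbour f m a y ≡ x
allowed-cons⁻¹ kautzFam m x y s ok with x ≟ᶠ y
allowed-cons⁻¹ kautzFam m x y s () | yes _
... | no x≢y = ok , punchOut (x≢y ∘ sym) , Fin.punchIn-punchOut (x≢y ∘ sym)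
allowed-cons⁻¹ deBruijnFam m x y s ok = refl , x , refl

allowed-pair : ∀ f m a y → Allowed f m (y ∷ neighbour f m a y ∷ [])
allowed-pair kautzFam m a y with y ≟ᶠ punchIn y a
... | yes y≡a = ⊥-elim (punchInᵢ≢i y a (sym y≡a))
... | no _ = refl
allowed-pair deBruijnFam m a y = refl

allowed-pair⁻¹ : ∀ f m y x → Allowed f m (y ∷ x ∷ []) → ∃ λ a → neighbour f m a y ≡ x
allowed-pair⁻¹ kautzFam m y x ok with y ≟ᶠ x
allowed-pair⁻¹ kautzFam m y x () | yes _
... | no y≢x = punchOut y≢x , Fin.punchIn-punchOut y≢x
allowed-pair⁻¹ deBruijnFam m y x ok = x , refl

allowed-single : ∀ f m x → Allowed f m (x ∷ [])
allowed-single kautzFam m x = refl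
allowed-single deBruijnFam m x = refl

allowed-tail : ∀ f m {k} (w : Word f m (suc (suc k))) → Allowed f m w → Allowed f m (tail w)
allowed-tail f m (x ∷ y ∷ s) ok = proj₁ (allowed-cons⁻¹ f m x y s ok)

allowed-snoc : ∀ f m {k} (t : Word f m (suc k)) a → Allowed f m t → Allowed f m (t ∷ʳ neighbour f m a (last t))
allowed-snoc f m (y ∷ []) a _ = allowed-pair f m a y
allowed-snoc f m (y ∷ z ∷ t) a ok with allowed-cons⁻¹ f m y z t ok
... | ok′ , b , refl = allowed-cons f m b z (t ∷ʳ _) (allowed-snoc f m (z ∷ t) a ok′)

allowed-snoc⁻¹ : ∀ f m {k} (t : Word f m (suc k)) x → Allowed f m (t ∷ʳ x) → ∃ λ a → neighbour f m a (last t) ≡ x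
allowed-snoc⁻¹ f m (y ∷ []) x ok = allowed-pair⁻¹ f m y x ok
allowed-snoc⁻¹ f m (y ∷ z ∷ t) x ok = allowed-snoc⁻¹ f m (z ∷ t) x (proj₁ (allowed-cons⁻¹ f m y z (t ∷ʳ x) ok))

init-∷ʳ-last : ∀ {A : Set} {k} (v : Vec A (suc k)) → init v ∷ʳ last v ≡ v
init-∷ʳ-last v = sym (proj₂ (proj₂ (initLast v)))

-- Two allowed words overlapping in all but one letter glue to an allowed word:
-- if tail u = init v then u ∷ʳ last v = head u ∷ v, and head u precedes head v in u.
allowed-join : ∀ f m {k} (u v : Word f m (suc (suc k))) → Allowed f m u → Allowed f m v →
  tail u ≡ init v → Allowed f m (u ∷ʳ last v)
allowed-join f m (x ∷ z ∷ u) (y ∷ v) ok-u ok-v tail≡init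
  with allowed-cons⁻¹ f m x z u ok-u | cong Vec.head tail≡init
... | _ , a , refl | refl =
  subst (Allowed f m) (cong (neighbour f m a z ∷_) (sym (trans (cong (_∷ʳ last (z ∷ v)) tail≡init) (init-∷ʳ-last (z ∷ v)))))
    (allowed-cons f m a z v ok-v)

-- Allowed words of length k+1 number count f m k: the alphabet size, times m
-- for each further letter (each letter has m possible predecessors).
count : Family → ℕ → ℕ → ℕ
count f m zero = alphabet f m
count f m (suc k) = m ℕ.* count f m k

prepend : ∀ f m {k} → Fin m → Word f m (suc k) → Word f m (suc (suc k))
prepend f m a w = neighbour f m a (Vec.head w) ∷ w

-- The enumeration of allowed words: an index in Fin (m · count f m k) splits as
-- (a , j) and names the j-th word prefixed by the a-th neighbour of its first letter.
word : ∀ f m k → Fin (count f m k) → Word f m (suc k)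
word f m zero x = x ∷ []
word f m (suc k) i = prepend f m (proj₁ q) (word f m k (proj₂ q))
  where q = Fin.remQuot {m} (count f m k) i

allowed-prepend : ∀ f m {k} a (w : Word f m (suc k)) → Allowed f m w → Allowed f m (prepend f m a w)
allowed-prepend f m a (y ∷ s) = allowed-cons f m a y s

word-allowed : ∀ f m k i → Allowed f m (word f m k i)
word-allowed f m zero x = allowed-single f m x
word-allowed f m (suc k) i = allowed-prepend f m (proj₁ q) (word f m k (proj₂ q)) (word-allowed f m k (proj₂ q))
  where q = Fin.remQuot {m} (count f m k) i

word-injective : ∀ f m k {i j} → word f m k i ≡ word f m k j → i ≡ j
word-injective f m zero eq = cong Vec.head eq
word-injective f m (suc k) {i} {j} eq = begin
  i                                     ≡⟨ sym (Fin.combine-remQuot {m} (count f m k) i) ⟩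
  Fin.combine (proj₁ qᵢ) (proj₂ qᵢ)     ≡⟨ cong₂ Fin.combine a≡b x≡y ⟩
  Fin.combine (proj₁ qⱼ) (proj₂ qⱼ)     ≡⟨ Fin.combine-remQuot {m} (count f m k) j ⟩
  j                                     ∎
  where
  open ≡-Reasoning
  qᵢ = Fin.remQuot {m} (count f m k) i
  qⱼ = Fin.remQuot {m} (count f m k) j
  x≡y : proj₂ qᵢ ≡ proj₂ qⱼ
  x≡y = word-injective f m k (cong tail eq)
  a≡b : proj₁ qᵢ ≡ proj₁ qⱼ
  a≡b = neighbour-injective f m _
    (trans (cong (λ x → neighbour f m (proj₁ qᵢ) (Vec.head (word f m k x))) (sym x≡y)) (cong Vec.head eq))

index : ∀ f m k (t : Word f m (suc k)) → Allowed f m t → Fin (count f m k)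
index f m zero (x ∷ []) _ = x
index f m (suc k) (x ∷ y ∷ s) ok =
  Fin.combine (proj₁ (proj₂ split)) (index f m k (y ∷ s) (proj₁ split))
  where split = allowed-cons⁻¹ f m x y s ok

word-index : ∀ f m k (t : Word f m (suc k)) (ok : Allowed f m t) → word f m k (index f m k t ok) ≡ t
word-index f m zero (x ∷ []) _ = refl
word-index f m (suc k) (x ∷ y ∷ s) ok with allowed-cons⁻¹ f m x y s ok
... | ok′ , a , refl = begin
  word f m (suc k) (Fin.combine a j)  ≡⟨ cong (λ q → prepend f m (proj₁ q) (word f m k (proj₂ q))) (Fin.remQuot-combine a j) ⟩
  prepend f m a (word f m k j)        ≡⟨ cong (prepend f m a) (word-index f m k (y ∷ s) ok′) ⟩
  prepend f m a (y ∷ s)               ∎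
  where
  open ≡-Reasoning
  j = index f m k (y ∷ s) ok′

words : ∀ f m k → Fin (count f m k) ⤖ Vertex f m (suc k)
words f m k = mk⤖ {to = λ i → word f m k i , word-allowed f m k i}
  ((λ eq → word-injective f m k (cong proj₁ eq)) ,
   (λ { (t , ok) → index f m k t ok , λ { refl → vertex-≡ {f} {m} (word-index f m k t ok) } }))

-- Two vertices are adjacent iff the tail of the
-- first is the initial word of the second, so with B j w = [tail v_j = w] and
-- C w j = [w = init v_j] the adjacency matrix is B ⊗ C; every out-degree is m,
-- so L ≡ B ⊗ C (mod m).  Selecting for each word a vertex with that tail
-- (resp. initial word) gives a left inverse of B (resp. right inverse of C).
-- Finally N = m · c, as both count the allowed words of length n+1.
module LineGraph (f : Family) (m′ n′ N : ℕ) (e : Fin N ⤖ Vertex f (suc m′) (suc (suc n′))) where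

  m n c : ℕ
  m = suc m′
  n = suc n′
  c = count f m n′

  open Inverse (⤖⇒↔ e) using ()
    renaming (to to vertex; from to position; strictlyInverseˡ to vertex-position; strictlyInverseʳ to position-vertex)

  vword : Fin N → Word f m (suc n)
  vword j = proj₁ (vertex j)

  vword-allowed : ∀ j → Allowed f m (vword j)
  vword-allowed j = proj₂ (vertex j)

  at : (t : Word f m (suc n)) → Allowed f m t → Fin N
  at t ok = position (t , ok)

  vword-at : ∀ t ok → vword (at t ok) ≡ t
  vword-at t ok = cong proj₁ (vertex-position (t , ok))

  at-unique : ∀ j t ok → vword j ≡ t → j ≡ at t ok
  at-unique j t ok vj≡t = trans (sym (position-vertex j)) (cong position (vertex-≡ {f} {m} vj≡t))

  midword : Fin c → Word f m n
  midword = word f m n′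

  infix 4 _≟ʷ_
  _≟ʷ_ : ∀ {k} (u v : Word f m k) → Dec (u ≡ v)
  _≟ʷ_ = ≡-dec _≟ᶠ_

  midword-indicator : ∀ w w′ → [ midword w ≟ʷ midword w′ ] ≡ identity w w′
  midword-indicator w w′ with w ≟ᶠ w′
  ... | yes refl = []-yes (midword w ≟ʷ midword w) refl
  ... | no w≢w′ = []-no (midword w ≟ʷ midword w′) (w≢w′ ∘ word-injective f m n′)

  B : Mat N c
  B j w = [ tail (vword j) ≟ʷ midword w ]

  C : Mat c N
  C w j = [ midword w ≟ʷ init (vword j) ]

  tail-index : Fin N → Fin c
  tail-index j = index f m n′ (tail (vword j)) (allowed-tail f m (vword j) (vword-allowed j))

  midword-tail-index : ∀ j → midword (tail-index j) ≡ tail (vword j)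
  midword-tail-index j = word-index f m n′ (tail (vword j)) (allowed-tail f m (vword j) (vword-allowed j))

  B⊗C : ∀ j j′ → (B ⊗ C) j j′ ≡ [ tail (vword j) ≟ʷ init (vword j′) ]
  B⊗C j j′ = begin
    (B ⊗ C) j j′            ≡⟨ sum-single _ w₀ (λ w w≢w₀ → trans (cong (_* C w j′) (B-off w w≢w₀)) (ℤ.*-zeroˡ (C w j′))) ⟩
    B j w₀ * C w₀ j′        ≡⟨ cong (_* C w₀ j′) ([]-yes (tail (vword j) ≟ʷ midword w₀) (sym (midword-tail-index j))) ⟩
    + 1 * C w₀ j′           ≡⟨ ℤ.*-identityˡ (C w₀ j′) ⟩
    C w₀ j′                 ≡⟨ cong (λ t → [ t ≟ʷ init (vword j′) ]) (midword-tail-index j) ⟩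
    [ tail (vword j) ≟ʷ init (vword j′) ] ∎
    where
    open ≡-Reasoning
    w₀ = tail-index j
    B-off : ∀ w → w ≢ w₀ → B j w ≡ + 0
    B-off w w≢w₀ = []-no (tail (vword j) ≟ʷ midword w)
      (λ t≡w → w≢w₀ (word-injective f m n′ (trans (sym t≡w) (sym (midword-tail-index j)))))

  adjacency : ∀ u v → + adjCount f m n u v ≡ [ tail (proj₁ u) ≟ʷ init (proj₁ v) ]
  adjacency (u , ok-u) (v , ok-v) with ≡-dec _≟ᶠ_ (tail u) (init v)
  ... | yes tail≡init rewrite allowed-join f m u v ok-u ok-v tail≡init = refl
  ... | no _ = refl

  -- An allowed word t of length n is the initial word of exactly m vertices,
  -- t ∷ʳ x for the m neighbours x of its last letter.
  successors : ∀ t → Allowed f m t → sum (λ j → [ t ≟ʷ init (vword j) ]) ≡ + m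
  successors t ok = sum-image _ h h-injective on-image off-image
    where
    h : Fin m → Fin N
    h a = at (t ∷ʳ neighbour f m a (last t)) (allowed-snoc f m t a ok)
    vword-h : ∀ a → vword (h a) ≡ t ∷ʳ neighbour f m a (last t)
    vword-h a = vword-at _ (allowed-snoc f m t a ok)
    h-injective : ∀ {a a′} → h a ≡ h a′ → a ≡ a′
    h-injective {a} {a′} ha≡ha′ = neighbour-injective f m (last t)
      (Vec.∷ʳ-injectiveʳ t t (trans (sym (vword-h a)) (trans (cong vword ha≡ha′) (vword-h a′))))
    on-image : ∀ a → [ t ≟ʷ init (vword (h a)) ] ≡ + 1
    on-image a = []-yes (t ≟ʷ init (vword (h a))) (sym (trans (cong init (vword-h a)) (Vec.init-∷ʳ _ t)))
    off-image : ∀ j → (∀ a → h a ≢ j) → [ t ≟ʷ init (vword j) ] ≡ + 0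
    off-image j not-h = []-no (t ≟ʷ init (vword j)) λ t≡init → not-h (a t≡init) (sym (at-unique j _ _ (vj≡ t≡init)))
      where
      v-allowed : Allowed f m (init (vword j) ∷ʳ last (vword j))
      v-allowed = subst (Allowed f m) (sym (init-∷ʳ-last (vword j))) (vword-allowed j)
      a : t ≡ init (vword j) → Fin m
      a refl = proj₁ (allowed-snoc⁻¹ f m t (last (vword j)) v-allowed)
      vj≡ : (t≡init : t ≡ init (vword j)) → vword j ≡ t ∷ʳ neighbour f m (a t≡init) (last t)
      vj≡ refl = trans (sym (init-∷ʳ-last (vword j)))
        (cong (t ∷ʳ_) (sym (proj₂ (allowed-snoc⁻¹ f m t (last (vword j)) v-allowed))))

  out-degree : ∀ j → + outdeg f m n N e j ≡ + m
  out-degree j = begin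
    + outdeg f m n N e j                                 ≡⟨ ∑ℕ≡sum (λ j′ → adjCount f m n (vertex j) (vertex j′)) ⟩
    sum (λ j′ → + adjCount f m n (vertex j) (vertex j′)) ≡⟨ sum-cong-≗ (λ j′ → adjacency (vertex j) (vertex j′)) ⟩
    sum (λ j′ → [ tail (vword j) ≟ʷ init (vword j′) ])   ≡⟨ successors _ (allowed-tail f m (vword j) (vword-allowed j)) ⟩
    + m                                                  ∎
    where open ≡-Reasoning

  degree≡0 : ∀ j j′ → degMatrix f m n N e j j′ ≡ + 0 mod + m
  degree≡0 j j′ with j ≟ᶠ j′
  ... | yes _ = ∣⇒mod-0 (subst (+ m ∣ˢ_) (sym (out-degree j)) Signed.∣-refl)
  ... | no _ = mod-refl

  laplacian≡BC : laplacian f m n N e ≋ B ⊗ C mod + m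
  laplacian≡BC j j′ = begin
    adjMatrix f m n N e j j′ - degMatrix f m n N e j j′  ≈⟨ mod-− (mod-refl {x = adjMatrix f m n N e j j′}) (degree≡0 j j′) ⟩
    adjMatrix f m n N e j j′ + + 0                        ≡⟨ ℤ.+-identityʳ (adjMatrix f m n N e j j′) ⟩
    + adjCount f m n (vertex j) (vertex j′)               ≡⟨ adjacency (vertex j) (vertex j′) ⟩
    [ tail (vword j) ≟ʷ init (vword j′) ]                 ≡⟨ sym (B⊗C j j′) ⟩
    (B ⊗ C) j j′                                          ∎
    where open ModReasoning (+ m)

  -- Selection matrices: for each word w, R picks the vertex obtained by
  -- prefixing a neighbour of its first letter (its tail is w) and T the vertex
  -- obtained by appending a neighbour of its last letter (its initial word is w).
  R : Mat c N
  R w j = identity (at (prepend f m zero (midword w)) (allowed-prepend f m zero _ (word-allowed f m n′ w))) j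

  T : Mat N c
  T j w = identity j (at (midword w ∷ʳ neighbour f m zero (last (midword w))) (allowed-snoc f m _ zero (word-allowed f m n′ w)))

  R⊗B≋I : R ⊗ B ≋ identity
  R⊗B≋I w w′ = begin
    (R ⊗ B) w w′                           ≡⟨ ⊗-identityˡ B _ w′ ⟩
    [ tail (vword ρ) ≟ʷ midword w′ ]       ≡⟨ cong (λ t → [ tail t ≟ʷ midword w′ ]) (vword-at _ _) ⟩
    [ midword w ≟ʷ midword w′ ]            ≡⟨ midword-indicator w w′ ⟩
    identity w w′                          ∎
    where
    open ≡-Reasoning
    ρ = at (prepend f m zero (midword w)) (allowed-prepend f m zero _ (word-allowed f m n′ w))

  C⊗T≋I : C ⊗ T ≋ identity
  C⊗T≋I w w′ = begin
    (C ⊗ T) w w′                           ≡⟨ ⊗-identityʳ C w _ ⟩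
    [ midword w ≟ʷ init (vword σ) ]        ≡⟨ cong (λ t → [ midword w ≟ʷ init t ]) (vword-at _ _) ⟩
    [ midword w ≟ʷ init (midword w′ ∷ʳ _) ] ≡⟨ cong (λ t → [ midword w ≟ʷ t ]) (Vec.init-∷ʳ _ (midword w′)) ⟩
    [ midword w ≟ʷ midword w′ ]            ≡⟨ midword-indicator w w′ ⟩
    identity w w′                          ∎
    where
    open ≡-Reasoning
    σ = at (midword w′ ∷ʳ neighbour f m zero (last (midword w′))) (allowed-snoc f m _ zero (word-allowed f m n′ w′))

  vertex-count : N ≡ m ℕ.* c
  vertex-count = ↔⇒≡ (↔-trans (⤖⇒↔ e) (↔-sym (⤖⇒↔ (words f m n))))

lemma5p4 : (f : Family) (m n : ℕ) → .{{_ : NonZero m}} → 1 ≤ n →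
    (N : ℕ) (e : Fin N ⤖ Vertex f m (suc n)) (S : Fin N → Fin N → ℤ) →
    IsSmithNormalFormOf S (laplacian f m n N e) →
    (∀ (i : Fin N) → toℕ i < N / m → Coprime ∣ S i i ∣ m)
    × (∀ (i : Fin N) → N / m ≤ toℕ i → (+ m) ∣ S i i)
lemma5p4 f zero _ {{m≢0}} = ⊥-elim (ℕ.≢-nonZero⁻¹ zero {{m≢0}} refl)
lemma5p4 f (suc m′) (suc n′) _ N e S snf =
  (λ i i<N/m → proj₁ (invariants i) (subst (toℕ i <_) N/m≡c i<N/m)) ,
  (λ i N/m≤i → proj₂ (invariants i) (subst (_≤ toℕ i) N/m≡c N/m≤i))
  where
  open LineGraph f m′ n′ N e
  invariants : ∀ i → (toℕ i < c → Coprime ∣ S i i ∣ m) × (c ≤ toℕ i → + m ∣ S i i)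
  invariants = smith-invariants m (laplacian f m n N e) B C R T laplacian≡BC R⊗B≋I C⊗T≋I S snf
  N/m≡c : N / m ≡ c
  N/m≡c = trans (cong (_/ m) (trans vertex-count (ℕ.*-comm m c))) (m*n/n≡m c m)
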